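{- Let $\Delta$ be a dynamic theory and $\Delta^{h}$ its havoc lift. Then $\Delta^{h}$ is a dynamic theory.
   Context: A dynamic theory $\Delta$ consists of: pairwise disjoint sets $\mathcal V$ (variables), $\mathcal A$ (atoms), $\mathcal P$ (programs); a nonempty set $U$; a nonempty set $S$ of states with $\mathrm{val}:S\times\mathcal V\to U$ satisfying interpolation (for all $\mu,\nu\in S$, $W\subseteq\mathcal V$ there is $\omega\in S$ agreeing with $\mu$ on $W$ and with $\nu$ outside $W$); $\mathcal E_A:\mathcal A\to2^S$ and $\mathrm{FV}_A:\mathcal A\to 2^{\mathcal V}$ with $\mathrm{FV}_A(a)$ finite and states agreeing on $\mathrm{FV}_A(a)$ both in or both out of $\mathcal E_A(a)$; $\mathcal E_P:\mathcal P\to 2^{S\times S}$ and $\mathrm{FV}_P:\mathcal P\to2^{\mathcal V}$ with $\mathrm{FV}_P(p)$ finite, overapproximation (for all $W\supseteq\mathrm{FV}_P(p)$: if $\mu=_W\nu$ and $(\mu,\omega)\in\mathcal E_P(p)$ then some $\tilde\omega$ has $(\nu,\tilde\omega)\in\mathcal E_P(p)$, $\omega=_W\tilde\omega$) and extensionality (if $\mu=_{\mathcal V}\nu$ then $(\mu,\omega)\in\mathcal E_P(p)\iff(\nu,\omega)\in\mathcal E_P(p)$). $\mu=_W\nu$ means $\mathrm{val}(\mu,v)=\mathrm{val}(\nu,v)$ for all $v\in W$. The havoc lift $\Delta^h$ has the same components as $\Delta$ except: programs $\mathcal P^h=\mathcal P\,\dot\cup\,\{v:=*\mid v\in\mathcal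 V\}$ (disjoint union of new syntactic programs); $\mathcal E_P^h(p)=\mathcal E_P(p)$ and $\mathrm{FV}_P^h(p)=\mathrm{FV}_P(p)$ for $p\in\mathcal P$; $\mathcal E_P^h(v:=*)=\{(\mu,\nu)\in S^2:\mu=_{\mathcal V\setminus\{v\}}\nu\}$ and $\mathrm{FV}_P^h(v:=*)=\emptyset$. -}

module Defs where

open import Level using (Level; _⊔_) renaming (suc to lsuc)
open import Data.Empty using (⊥)
open import Data.Product using (Σ; ∃; _×_; _,_)
open import Data.Sum using (_⊎_; inj₁; inj₂)
open import Data.List using (List)
open import Data.List.Membership.Propositional using (_∈_)
open import Relation.Nullary using (¬_)
open import Relation.Binary.PropositionalEquality using (_≡_)

Finite : ∀ {ℓ} {X : Set ℓ} → (X → Set ℓ) → Set ℓ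
Finite {X = X} W = Σ (List X) λ xs → ∀ x → W x → x ∈ xs

_⊆_ : ∀ {ℓ} {X : Set ℓ} → (X → Set ℓ) → (X → Set ℓ) → Set ℓ
W₁ ⊆ W₂ = ∀ x → W₁ x → W₂ x

-- The data (signature + semantics) of a would-be dynamic theory.
-- V, A, P are separate types, hence automatically pairwise disjoint.
record DynData (ℓ : Level) : Set (lsuc ℓ) where
  field
    V A P U S : Set ℓ
    val : S → V → U
    EA  : A → S → Set ℓ
    FVA : A → V → Set ℓ
    EP  : P → S → S → Set ℓ
    FVP : P → V → Set ℓ

  Agree : (V → Set ℓ) → S → S → Set ℓ
  Agree W μ ν = ∀ v → W v → val μ v ≡ val ν v

  AgreeAll : S → S → Set ℓ
  AgreeAll μ ν = ∀ v → val μ v ≡ val ν v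

record IsDynamicTheory {ℓ : Level} (D : DynData ℓ) : Set (lsuc ℓ) where
  open DynData D
  field
    U-nonempty : U
    S-nonempty : S
    interpolation : ∀ (μ ν : S) (W : V → Set ℓ) →
      Σ S λ ω → Agree W ω μ × (∀ v → ¬ W v → val ω v ≡ val ν v)
    FVA-finite : ∀ a → Finite (FVA a)
    FVA-coincidence : ∀ a μ ν → Agree (FVA a) μ ν → (EA a μ → EA a ν) × (EA a ν → EA a μ)
    FVP-finite : ∀ p → Finite (FVP p)
    overapproximation : ∀ p (W : V → Set ℓ) → FVP p ⊆ W → ∀ μ ν ω →
      Agree W μ ν → EP p μ ω → Σ S λ ω̃ → EP p ν ω̃ × Agree W ω ω̃
    extensionality : ∀ p μ ν ω → AgreeAll μ ν → (EP p μ ω → EP p ν ω) × (EP p ν ω → EP p μ ω)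

-- The havoc lift Δʰ: programs P ⊎ V, where inj₂ v is the program v := *.
havocLift : ∀ {ℓ} → DynData ℓ → DynData ℓ
havocLift D = record
  { V = V ; A = A ; P = P ⊎ V ; U = U ; S = S ; val = val
  ; EA = EA ; FVA = FVA
  ; EP = EPh ; FVP = FVPh }
  where
    open DynData D
    EPh : P ⊎ V → S → S → Set _
    EPh (inj₁ p) = EP p
    EPh (inj₂ v) μ ν = Agree (λ u → ¬ (u ≡ v)) μ ν
    FVPh : P ⊎ V → V → Set _
    FVPh (inj₁ p) = FVP p
    FVPh (inj₂ v) _ = Lift⊥
      where open import Data.Empty.Polymorphic renaming (⊥ to Lift⊥)

{-# OPTIONS --safe #-}
module Submission where

open import Defs
open import Level using (Level; suc)
open import Axiom.ExcludedMiddle using (ExcludedMiddle)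
open import Data.Product using (Σ; _×_; _,_; proj₁; proj₂)
open import Data.Sum using (inj₁; inj₂)
open import Data.List using ([])
open import Relation.Nullary using (¬_; yes; no)
open import Relation.Binary.Definitions using (DecidableEquality)
open import Relation.Binary.PropositionalEquality using (_≡_; sym; trans)

-- A program v := * relates exactly the states that agree off v, so the only
-- nontrivial axiom is overapproximation: a successor of ν is obtained by
-- interpolating the given successor ω (on v) with ν (off v), and deciding
-- whether a variable is v needs excluded middle.

module _ {ℓ : Level} (D : DynData ℓ) where
  open DynData D
  open DynData (havocLift D) using () renaming (FVP to FVPʰ)

  Interpolation : Set (suc ℓ)
  Interpolation = ∀ (μ ν : S) (W : V → Set ℓ) →
    Σ S λ ω → Agree W ω μ × (∀ v → ¬ W v → val ω v ≡ val ν v)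

  Havoc : V → S → S → Set ℓ
  Havoc v = Agree (λ u → ¬ u ≡ v)

  havoc-extensional : ∀ v μ ν ω → AgreeAll μ ν →
    (Havoc v μ ω → Havoc v ν ω) × (Havoc v ν ω → Havoc v μ ω)
  havoc-extensional v μ ν ω μ=ν =
      (λ μ~ω u u≢v → trans (sym (μ=ν u)) (μ~ω u u≢v))
    , (λ ν~ω u u≢v → trans (μ=ν u) (ν~ω u u≢v))

  havoc-overapproximation : DecidableEquality V → Interpolation →
    ∀ v (W : V → Set ℓ) μ ν ω → Agree W μ ν → Havoc v μ ω →
    Σ S λ ω̃ → Havoc v ν ω̃ × Agree W ω ω̃
  havoc-overapproximation _≟_ interpolate v W μ ν ω μ=ν μ~ω =
    ω̃ , ν~ω̃ , ω=ω̃
    where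
    interpolant : Σ S λ ω̃ → Agree (_≡ v) ω̃ ω × (∀ u → ¬ u ≡ v → val ω̃ u ≡ val ν u)
    interpolant = interpolate ω ν (_≡ v)
    ω̃ : S
    ω̃ = proj₁ interpolant
    ω̃=ω : Agree (_≡ v) ω̃ ω
    ω̃=ω = proj₁ (proj₂ interpolant)
    ν~ω̃ : Havoc v ν ω̃
    ν~ω̃ u u≢v = sym (proj₂ (proj₂ interpolant) u u≢v)
    ω=ω̃ : Agree W ω ω̃
    ω=ω̃ u u∈W with u ≟ v
    ... | yes u≡v = sym (ω̃=ω u u≡v)
    ... | no  u≢v = trans (sym (μ~ω u u≢v)) (trans (μ=ν u u∈W) (ν~ω̃ u u≢v))

  havocLift-FVP-finite : (∀ p → Finite (FVP p)) → ∀ p → Finite (FVPʰ p)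
  havocLift-FVP-finite FVP-finite (inj₁ p) = FVP-finite p
  havocLift-FVP-finite FVP-finite (inj₂ v) = [] , λ _ ()

mainTheorem5 : ∀ {ℓ : Level} → ExcludedMiddle ℓ → (D : DynData ℓ) →
    IsDynamicTheory D → IsDynamicTheory (havocLift D)
mainTheorem5 em D T = record
  { U-nonempty = U-nonempty
  ; S-nonempty = S-nonempty
  ; interpolation = interpolation
  ; FVA-finite = FVA-finite
  ; FVA-coincidence = FVA-coincidence
  ; FVP-finite = havocLift-FVP-finite D FVP-finite
  ; overapproximation = λ
      { (inj₁ p) → overapproximation p
      ; (inj₂ v) W _ → havoc-overapproximation D (λ _ _ → em) interpolation v W }
  ; extensionality = λ
      { (inj₁ p) → extensionality p
      ; (inj₂ v) → havoc-extensional D v }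
  }
  where open IsDynamicTheory T
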